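{- Let $q=2^r$, $i\in\{1,2\}$, and let $\{C_{i,j}^\pm(n,q)\}_{j=0}^{N}$, with $N=|DC_i^\pm(n,q)|$, be the weight distribution of the binary code $C(DC_i^\pm(n,q))$. Then $C_{i,j}^\pm(n,q)=C_{i,N-j}^\pm(n,q)$ for all $j$ with $0\le j\le N$.
   Context: Let $q=2^r$ and let $\mathbb{F}_q$ be the field with $q$ elements. $Tr$ is the matrix trace. $O^+(2n,q)$ is the group of $g\in GL(2n,q)$ preserving $\theta^+(x)=\sum_{i=1}^nx_ix_{n+i}$. $P^+=P^+(2n,q)$ is the subgroup of all products $\begin{bmatrix}A&0\\0&{}^tA^{ -1}\end{bmatrix}\begin{bmatrix}1_n&B\\0&1_n\end{bmatrix}$ with $A\in GL(n,q)$ and $B$ an $n\times n$ symmetric matrix with zero diagonal. For $0\le s\le n$, $\sigma_s^+$ is the $2n\times2n$ matrix which, in block form for $2n=s+(n-s)+s+(n-s)$, is $\begin{bmatrix}0&0&1_s&0\\0&1_{n-s}&0&0\\1_s&0&0&0\\0&0&0&1_{n-s}\end{bmatrix}$. The double cosets are: - $DC_1^+(n,q)=P^+\sigma_{n-1}^+P^+$ and $DC_2^+(n,q)=P^+\sigma_{n-2}^+P^+$ for even $n\ge2$; - $DC_1^-(n,q)=P^+\sigma_{n-1}^+P^+$ for odd $n\ge1$; - $DC_2^-(n,q)=P^+\sigma_{n-2}^+P^+$ for odd $n\ge3$. For such a double coset $D$ with elements ordered $g_1,\dots,g_N$, the binary code is $C(D)=\{u\in\mathbb{F}_2^N:\sum_ju_j\,Tr\,g_j=0\text{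 in }\mathbb{F}_q\}$. Its weight distribution counts codewords of each Hamming weight $j$. -}

module Defs where

open import Level using (0ℓ)
open import Data.Nat as ℕ using (ℕ; zero; suc; _<ᵇ_)
open import Data.Bool using (Bool; true; false; if_then_else_; _∧_; not)
open import Data.Fin as Fin using (Fin; splitAt; toℕ)
open import Data.Fin.Properties as FinP using ()
open import Data.Sum using (_⊎_; inj₁; inj₂)
open import Data.Product using (Σ; ∃; _×_; _,_)
open import Data.List using (List; []; _∷_; length; filterᵇ; map; _++_)
open import Data.Vec as Vec using (Vec; []; _∷_)
open import Relation.Binary.PropositionalEquality using (_≡_; _≢_)
open import Relation.Nullary using (¬_; does)
open import Algebra.Structures using (IsCommutativeRing)
open import Function.Bundles using (_↔_; Inverse)

record FiniteField (q : ℕ) : Set₁ where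
  infixl 7 _*_
  infixl 6 _+_
  field
    Carrier : Set
    _+_ _*_ : Carrier → Carrier → Carrier
    -_      : Carrier → Carrier
    0# 1#   : Carrier
    isCommutativeRing : IsCommutativeRing _≡_ _+_ _*_ -_ 0# 1#
    0≢1     : 0# ≢ 1#
    inverse : ∀ x → x ≢ 0# → ∃ λ y → x * y ≡ 1#
    enum    : Carrier ↔ Fin q

  _==_ : Carrier → Carrier → Bool
  x == y = does (Inverse.to enum x FinP.≟ Inverse.to enum y)

module Matrices {q : ℕ} (F : FiniteField q) where
  open FiniteField F

  Mat : ℕ → Set
  Mat m = Fin m → Fin m → Carrier

  ∑ : ∀ {m} → (Fin m → Carrier) → Carrier
  ∑ {zero}  f = 0#
  ∑ {suc m} f = f Fin.zero + ∑ (λ k → f (Fin.suc k))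

  _⊗_ : ∀ {m} → Mat m → Mat m → Mat m
  (M ⊗ N) i j = ∑ (λ k → M i k * N k j)

  I : ∀ {m} → Mat m
  I i j = if does (i FinP.≟ j) then 1# else 0#

  transpose : ∀ {m} → Mat m → Mat m
  transpose M i j = M j i

  Tr : ∀ {m} → Mat m → Carrier
  Tr M = ∑ (λ k → M k k)

  _≋_ : ∀ {m} → Mat m → Mat m → Set
  M ≋ N = ∀ i j → M i j ≡ N i j

  block : ∀ {n} → Mat n → Mat n → Mat n → Mat n → Mat (n ℕ.+ n)
  block {n} A B C D i j with splitAt n i | splitAt n j
  ... | inj₁ a | inj₁ b = A a b
  ... | inj₁ a | inj₂ b = B a b
  ... | inj₂ a | inj₁ b = C a b
  ... | inj₂ a | inj₂ b = D a b

  Zero : ∀ {n} → Mat n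
  Zero _ _ = 0#

  Symmetric : ∀ {n} → Mat n → Set
  Symmetric B = ∀ i j → B i j ≡ B j i

  ZeroDiagonal : ∀ {n} → Mat n → Set
  ZeroDiagonal B = ∀ i → B i i ≡ 0#

  InP⁺ : (n : ℕ) → Mat (n ℕ.+ n) → Set
  InP⁺ n M =
    Σ (Mat n) λ A → Σ (Mat n) λ A' →
      (A ⊗ A') ≋ I × (A' ⊗ A) ≋ I ×
      Σ (Mat n) λ B → Symmetric B × ZeroDiagonal B ×
        M ≋ (block A Zero Zero (transpose A') ⊗ block I B Zero I)

  -- σ_s⁺ : block form for 2n = s + (n-s) + s + (n-s):
  -- swaps coordinates k and n+k for k < s, fixes the others
  σ⁺ : (n s : ℕ) → Mat (n ℕ.+ n)
  σ⁺ n s = block D₁ D₂ D₂ D₁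
    where
      D₁ D₂ : Mat n
      D₁ a b = if does (a FinP.≟ b) ∧ not (toℕ a <ᵇ s) then 1# else 0#
      D₂ a b = if does (a FinP.≟ b) ∧ (toℕ a <ᵇ s) then 1# else 0#

  InDoubleCoset : (n s : ℕ) → Mat (n ℕ.+ n) → Set
  InDoubleCoset n s g =
    Σ (Mat (n ℕ.+ n)) λ p₁ → Σ (Mat (n ℕ.+ n)) λ p₂ →
      InP⁺ n p₁ × InP⁺ n p₂ × g ≋ ((p₁ ⊗ σ⁺ n s) ⊗ p₂)

  record EnumeratesDoubleCoset (n s N : ℕ) (gs : Vec (Mat (n ℕ.+ n)) N) : Set where
    field
      sound    : ∀ k → InDoubleCoset n s (Vec.lookup gs k)
      complete : ∀ g → InDoubleCoset n s g → ∃ λ k → g ≋ Vec.lookup gs k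
      distinct : ∀ k l → Vec.lookup gs k ≋ Vec.lookup gs l → k ≡ l

  allVecs : (N : ℕ) → List (Vec Bool N)
  allVecs zero    = [] ∷ []
  allVecs (suc N) = map (false ∷_) (allVecs N) ++ map (true ∷_) (allVecs N)

  weight : ∀ {N} → Vec Bool N → ℕ
  weight []           = 0
  weight (false ∷ u) = weight u
  weight (true ∷ u)  = suc (weight u)

  inCodeᵇ : ∀ {n N} → Vec (Mat (n ℕ.+ n)) N → Vec Bool N → Bool
  inCodeᵇ {n} gs u =
    ∑ (λ k → if Vec.lookup u k then Tr {n ℕ.+ n} (Vec.lookup gs k) else 0#) == 0#

  weightDistribution : ∀ {n N} → Vec (Mat (n ℕ.+ n)) N → ℕ → ℕ
  weightDistribution {n} {N} gs j =
    length (filterᵇ (λ u → inCodeᵇ {n} gs u ∧ does (weight u ℕ.≟ j)) (allVecs N))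

{-# OPTIONS --safe #-}
-- Complementation u ↦ ¬u reverses Hamming weight, and it maps C(D) onto itself as soon as
-- ∑_{g ∈ D} Tr g = 0, because the code sums of u and ¬u add up to that total.  The total trace
-- vanishes because S = ∑_{g ∈ D} g is fixed by left multiplication with every Levi element
-- diag(C, ᵗC⁻¹) of P⁺, which permutes D.  Comparing entries of diag(C, ᵗC⁻¹) S = S for a
-- transvection C (n ≥ 2) or a scalar C = μ with μ ∉ {0, 1} kills the diagonal of S.  In the one
-- remaining case n = 1, q = 2 the group P⁺ is trivial, so D = {σ} and Tr σ = d + d = 0.
module Submission where

open import Defs
open import Data.Nat using (ℕ; zero; suc; _≤_; _∸_; _^_)
import Data.Nat as ℕ
import Data.Nat.Properties as ℕP
open import Data.Sum using (_⊎_; inj₁; inj₂)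
open import Data.Vec using (Vec; []; _∷_)
import Data.Vec as Vec
import Data.Vec.Properties as VecP
open import Level using (0ℓ)
open import Algebra.Bundles using (CommutativeRing)
open import Algebra.Structures using (IsCommutativeRing)
open import Data.Bool using (Bool; true; false; if_then_else_; _∧_; not; T?)
open import Data.Empty using (⊥-elim)
open import Data.Fin as Fin using (Fin; zero; suc; _↑ˡ_; _↑ʳ_; splitAt)
open import Data.Fin.Properties as FinP using (splitAt-↑ˡ; splitAt-↑ʳ; splitAt⁻¹-↑ˡ; splitAt⁻¹-↑ʳ)
import Data.Fin.Permutation as Perm
open import Data.List using ([]; _∷_; length; filterᵇ; map; _++_)
import Data.List.Properties as ListP
open import Data.List.Relation.Binary.Permutation.Propositional using (_↭_; ↭-refl; module PermutationReasoning)
import Data.List.Relation.Binary.Permutation.Propositional.Properties as ↭P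
open import Data.Product using (∃; _×_; _,_; proj₁; proj₂)
open import Function using (_∘_; _⇔_; mk⇔)
open import Function.Bundles using (Inverse)
open import Function.Properties.Inverse using (↔⇒↣)
open import Relation.Binary using (Setoid; IsEquivalence; DecidableEquality)
open import Relation.Binary.PropositionalEquality
  using (_≡_; _≢_; refl; sym; trans; cong; cong₂; subst; _≗_; module ≡-Reasoning)
import Relation.Binary.Reasoning.Setoid as SetoidReasoning
open import Relation.Nullary using (yes; no; does; ¬?)
open import Relation.Nullary.Decidable using (via-injection; does-⇔; _×-dec_)

length-filterᵇ-map : ∀ {A B : Set} (f : A → B) {p : B → Bool} {p' : A → Bool} → (∀ x → p (f x) ≡ p' x) →
                     ∀ xs → length (filterᵇ p (map f xs)) ≡ length (filterᵇ p' xs)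
length-filterᵇ-map f         p∘f≗p' []       = refl
length-filterᵇ-map f {p} {p'} p∘f≗p' (x ∷ xs) with p (f x) | p' x | p∘f≗p' x
... | true  | .true  | refl = cong suc (length-filterᵇ-map f p∘f≗p' xs)
... | false | .false | refl = length-filterᵇ-map f p∘f≗p' xs

module Over {q : ℕ} (F : FiniteField q) where
  open FiniteField F
  open Matrices F
  open IsCommutativeRing isCommutativeRing using
    ( +-assoc; +-comm; +-identityˡ; +-identityʳ; *-assoc; *-comm; *-identityˡ; *-identityʳ
    ; distribˡ; distribʳ; zeroˡ; zeroʳ; -‿inverseˡ; -‿inverseʳ )

  private
    ring : CommutativeRing 0ℓ 0ℓ
    ring = record { isCommutativeRing = isCommutativeRing }

  open import Algebra.Properties.Semiring.Sum (CommutativeRing.semiring ring) as Σ using (sum)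
  open import Algebra.Properties.Ring (CommutativeRing.ring ring)
    using (+-identityʳ-unique; x∙y⁻¹≈ε⇒x≈y; [y-z]x≈yx-zx)

  ∑≡sum : ∀ {m} (f : Fin m → Carrier) → ∑ f ≡ sum f
  ∑≡sum {zero}  f = refl
  ∑≡sum {suc m} f = cong (f zero +_) (∑≡sum (f ∘ suc))

  ∑-cong : ∀ {m} {f g : Fin m → Carrier} → f ≗ g → ∑ f ≡ ∑ g
  ∑-cong {f = f} {g} f≗g = trans (∑≡sum f) (trans (Σ.sum-cong-≗ f≗g) (sym (∑≡sum g)))

  ∑-zero : ∀ {m} {f : Fin m → Carrier} → (∀ k → f k ≡ 0#) → ∑ f ≡ 0#
  ∑-zero {zero}  f≡0 = refl
  ∑-zero {suc m} f≡0 = trans (cong₂ _+_ (f≡0 zero) (∑-zero (f≡0 ∘ suc))) (+-identityˡ 0#)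

  ∑-0* : ∀ {m} (f : Fin m → Carrier) → ∑ (λ k → 0# * f k) ≡ 0#
  ∑-0* f = ∑-zero (λ k → zeroˡ (f k))

  ∑-distrib-+ : ∀ {m} (f g : Fin m → Carrier) → ∑ (λ k → f k + g k) ≡ ∑ f + ∑ g
  ∑-distrib-+ f g = trans (∑≡sum (λ k → f k + g k)) (trans (Σ.∑-distrib-+ f g) (sym (cong₂ _+_ (∑≡sum f) (∑≡sum g))))

  ∑-comm : ∀ {m n} (f : Fin m → Fin n → Carrier) → ∑ (λ i → ∑ (f i)) ≡ ∑ (λ j → ∑ (λ i → f i j))
  ∑-comm f = begin
    ∑ (λ i → ∑ (f i))              ≡⟨ ∑-cong (λ i → ∑≡sum (f i)) ⟩
    ∑ (λ i → sum (f i))            ≡⟨ ∑≡sum (λ i → sum (f i)) ⟩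
    sum (λ i → sum (f i))          ≡⟨ Σ.∑-comm f ⟩
    sum (λ j → sum (λ i → f i j))  ≡⟨ ∑≡sum (λ j → sum (λ i → f i j)) ⟨
    ∑ (λ j → sum (λ i → f i j))    ≡⟨ ∑-cong (λ j → ∑≡sum (λ i → f i j)) ⟨
    ∑ (λ j → ∑ (λ i → f i j))      ∎
    where open ≡-Reasoning

  ∑-permute : ∀ {m} (f : Fin m → Carrier) (π : Perm.Permutation m m) → ∑ f ≡ ∑ (λ i → f (π Perm.⟨$⟩ʳ i))
  ∑-permute f π = trans (∑≡sum f) (trans (Σ.∑-permute f π) (sym (∑≡sum (λ i → f (π Perm.⟨$⟩ʳ i)))))

  *-distribˡ-∑ : ∀ {m} x (f : Fin m → Carrier) → x * ∑ f ≡ ∑ (λ k → x * f k)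
  *-distribˡ-∑ x f = trans (cong (x *_) (∑≡sum f)) (trans (Σ.*-distribˡ-sum x f) (sym (∑≡sum (λ k → x * f k))))

  *-distribʳ-∑ : ∀ {m} x (f : Fin m → Carrier) → ∑ f * x ≡ ∑ (λ k → f k * x)
  *-distribʳ-∑ x f = trans (cong (_* x) (∑≡sum f)) (trans (Σ.*-distribʳ-sum x f) (sym (∑≡sum (λ k → f k * x))))

  ∑-splitAt : ∀ m {n} (f : Fin (m ℕ.+ n) → Carrier) → ∑ f ≡ ∑ (λ a → f (a ↑ˡ n)) + ∑ (λ b → f (m ↑ʳ b))
  ∑-splitAt zero    f = sym (+-identityˡ _)
  ∑-splitAt (suc m) f = trans (cong (f zero +_) (∑-splitAt m (f ∘ suc))) (sym (+-assoc _ _ _))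

  fixedPoint≡0 : ∀ {μ x} → μ ≢ 1# → μ * x ≡ x → x ≡ 0#
  fixedPoint≡0 {μ} {x} μ≢1 μx≡x with inverse (μ + - 1#) (μ≢1 ∘ x∙y⁻¹≈ε⇒x≈y μ 1#)
  ... | w , [μ-1]w≡1 = begin
    x                      ≡⟨ *-identityˡ x ⟨
    1# * x                 ≡⟨ cong (_* x) (trans (sym [μ-1]w≡1) (*-comm (μ + - 1#) w)) ⟩
    w * (μ + - 1#) * x     ≡⟨ *-assoc w (μ + - 1#) x ⟩
    w * ((μ + - 1#) * x)   ≡⟨ cong (w *_) [μ-1]x≡0 ⟩
    w * 0#                 ≡⟨ zeroʳ w ⟩
    0#                     ∎
    where
      open ≡-Reasoning
      [μ-1]x≡0 : (μ + - 1#) * x ≡ 0#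
      [μ-1]x≡0 = trans ([y-z]x≈yx-zx x μ 1#) (trans (cong₂ (λ y z → y + - z) μx≡x (*-identityˡ x)) (-‿inverseʳ x))

  I-diag : ∀ {m} (a : Fin m) → I a a ≡ 1#
  I-diag a with a FinP.≟ a
  ... | yes _   = refl
  ... | no  a≢a = ⊥-elim (a≢a refl)

  I-≢ : ∀ {m} {a b : Fin m} → a ≢ b → I a b ≡ 0#
  I-≢ {a = a} {b} a≢b with a FinP.≟ b
  ... | yes a≡b = ⊥-elim (a≢b a≡b)
  ... | no  _   = refl

  I-reindex : ∀ {m m'} (f : Fin m → Fin m') → (∀ {a b} → f a ≡ f b → a ≡ b) → ∀ a b → I (f a) (f b) ≡ I a b
  I-reindex f f-injective a b =
    cong (λ c → if c then 1# else 0#) (does-⇔ (mk⇔ f-injective (cong f)) (f a FinP.≟ f b) (a FinP.≟ b))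

  I-sym : ∀ {m} (a b : Fin m) → I a b ≡ I b a
  I-sym a b = cong (λ c → if c then 1# else 0#) (does-⇔ (mk⇔ sym sym) (a FinP.≟ b) (b FinP.≟ a))

  ∑-I* : ∀ {m} (a : Fin m) (f : Fin m → Carrier) → ∑ (λ k → I a k * f k) ≡ f a
  ∑-I* {suc m} zero    f =
    trans (cong₂ _+_ (*-identityˡ (f zero)) (∑-0* (f ∘ suc))) (+-identityʳ _)
  ∑-I* {suc m} (suc a) f =
    trans (cong₂ _+_ (zeroˡ (f zero)) (∑-I* a (f ∘ suc))) (+-identityˡ _)

  ≋-isEquivalence : ∀ {m} → IsEquivalence (_≋_ {m})
  ≋-isEquivalence = record
    { refl  = λ _ _ → refl
    ; sym   = λ M≋N i j → sym (M≋N i j)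
    ; trans = λ M≋N N≋P i j → trans (M≋N i j) (N≋P i j)
    }

  ≋-setoid : ℕ → Setoid 0ℓ 0ℓ
  ≋-setoid m = record { isEquivalence = ≋-isEquivalence {m} }

  module ≋ {m} = IsEquivalence (≋-isEquivalence {m})
  module ≋-Reasoning {m} = SetoidReasoning (≋-setoid m)

  ⊗-cong : ∀ {m} {M M' N N' : Mat m} → M ≋ M' → N ≋ N' → (M ⊗ N) ≋ (M' ⊗ N')
  ⊗-cong M≋M' N≋N' i j = ∑-cong (λ k → cong₂ _*_ (M≋M' i k) (N≋N' k j))

  ⊗-assoc : ∀ {m} (M N P : Mat m) → ((M ⊗ N) ⊗ P) ≋ (M ⊗ (N ⊗ P))
  ⊗-assoc M N P i j = begin
    ∑ (λ k → ∑ (λ l → M i l * N l k) * P k j)  ≡⟨ ∑-cong (λ k → *-distribʳ-∑ (P k j) (λ l → M i l * N l k)) ⟩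
    ∑ (λ k → ∑ (λ l → M i l * N l k * P k j))  ≡⟨ ∑-comm (λ k l → M i l * N l k * P k j) ⟩
    ∑ (λ l → ∑ (λ k → M i l * N l k * P k j))  ≡⟨ ∑-cong (λ l → ∑-cong (λ k → *-assoc (M i l) (N l k) (P k j))) ⟩
    ∑ (λ l → ∑ (λ k → M i l * (N l k * P k j))) ≡⟨ ∑-cong (λ l → *-distribˡ-∑ (M i l) (λ k → N l k * P k j)) ⟨
    ∑ (λ l → M i l * ∑ (λ k → N l k * P k j))  ∎
    where open ≡-Reasoning

  ⊗-identityˡ : ∀ {m} (M : Mat m) → (I ⊗ M) ≋ M
  ⊗-identityˡ M i j = ∑-I* i (λ k → M k j)

  ⊗-identityʳ : ∀ {m} (M : Mat m) → (M ⊗ I) ≋ M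
  ⊗-identityʳ M i j = trans (∑-cong (λ k → trans (*-comm (M i k) (I k j)) (cong (_* M i k) (I-sym k j))))
                            (∑-I* j (λ k → M i k))

  ⊗-inverse : ∀ {m} {M M' N N' : Mat m} → (M ⊗ M') ≋ I → (N ⊗ N') ≋ I → ((M ⊗ N) ⊗ (N' ⊗ M')) ≋ I
  ⊗-inverse {M = M} {M'} {N} {N'} MM' NN' = begin
    (M ⊗ N) ⊗ (N' ⊗ M')  ≈⟨ ⊗-assoc M N (N' ⊗ M') ⟩
    M ⊗ (N ⊗ (N' ⊗ M'))  ≈⟨ ⊗-cong ≋.refl (⊗-assoc N N' M') ⟨
    M ⊗ ((N ⊗ N') ⊗ M')  ≈⟨ ⊗-cong ≋.refl (⊗-cong NN' ≋.refl) ⟩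
    M ⊗ (I ⊗ M')         ≈⟨ ⊗-cong ≋.refl (⊗-identityˡ M') ⟩
    M ⊗ M'               ≈⟨ MM' ⟩
    I                    ∎
    where open ≋-Reasoning

  ∑ᴹ : ∀ {m N} → (Fin N → Mat m) → Mat m
  ∑ᴹ G i j = ∑ (λ k → G k i j)

  ⊗-distribˡ-∑ᴹ : ∀ {m N} (M : Mat m) (G : Fin N → Mat m) → (M ⊗ ∑ᴹ G) ≋ ∑ᴹ (λ k → M ⊗ G k)
  ⊗-distribˡ-∑ᴹ M G i j = begin
    ∑ (λ l → M i l * ∑ (λ k → G k l j))  ≡⟨ ∑-cong (λ l → *-distribˡ-∑ (M i l) (λ k → G k l j)) ⟩
    ∑ (λ l → ∑ (λ k → M i l * G k l j))  ≡⟨ ∑-comm (λ l k → M i l * G k l j) ⟩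
    ∑ (λ k → ∑ (λ l → M i l * G k l j))  ∎
    where open ≡-Reasoning

  Tr-cong : ∀ {m} {M N : Mat m} → M ≋ N → Tr M ≡ Tr N
  Tr-cong M≋N = ∑-cong (λ i → M≋N i i)

  Tr-∑ᴹ : ∀ {m N} (G : Fin N → Mat m) → Tr (∑ᴹ G) ≡ ∑ (λ k → Tr (G k))
  Tr-∑ᴹ G = ∑-comm (λ i k → G k i i)

  module _ {n : ℕ} (A B C D : Mat n) (a b : Fin n) where
    block-↑ˡ-↑ˡ : block A B C D (a ↑ˡ n) (b ↑ˡ n) ≡ A a b
    block-↑ˡ-↑ˡ rewrite splitAt-↑ˡ n a n | splitAt-↑ˡ n b n = refl

    block-↑ˡ-↑ʳ : block A B C D (a ↑ˡ n) (n ↑ʳ b) ≡ B a b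
    block-↑ˡ-↑ʳ rewrite splitAt-↑ˡ n a n | splitAt-↑ʳ n n b = refl

    block-↑ʳ-↑ˡ : block A B C D (n ↑ʳ a) (b ↑ˡ n) ≡ C a b
    block-↑ʳ-↑ˡ rewrite splitAt-↑ʳ n n a | splitAt-↑ˡ n b n = refl

    block-↑ʳ-↑ʳ : block A B C D (n ↑ʳ a) (n ↑ʳ b) ≡ D a b
    block-↑ʳ-↑ʳ rewrite splitAt-↑ʳ n n a | splitAt-↑ʳ n n b = refl

  module _ {n : ℕ} where
    splitAt-elim : (P : Fin (n ℕ.+ n) → Set) → (∀ a → P (a ↑ˡ n)) → (∀ b → P (n ↑ʳ b)) → ∀ i → P i
    splitAt-elim P P↑ˡ P↑ʳ i with splitAt n i in eq
    ... | inj₁ a = subst P (splitAt⁻¹-↑ˡ eq) (P↑ˡ a)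
    ... | inj₂ b = subst P (splitAt⁻¹-↑ʳ eq) (P↑ʳ b)

    ≋-byBlocks : {M N : Mat (n ℕ.+ n)} →
      (∀ a b → M (a ↑ˡ n) (b ↑ˡ n) ≡ N (a ↑ˡ n) (b ↑ˡ n)) →
      (∀ a b → M (a ↑ˡ n) (n ↑ʳ b) ≡ N (a ↑ˡ n) (n ↑ʳ b)) →
      (∀ a b → M (n ↑ʳ a) (b ↑ˡ n) ≡ N (n ↑ʳ a) (b ↑ˡ n)) →
      (∀ a b → M (n ↑ʳ a) (n ↑ʳ b) ≡ N (n ↑ʳ a) (n ↑ʳ b)) → M ≋ N
    ≋-byBlocks {M} {N} e₁₁ e₁₂ e₂₁ e₂₂ =
      splitAt-elim (λ i → ∀ j → M i j ≡ N i j)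
        (λ a → splitAt-elim (λ j → M (a ↑ˡ n) j ≡ N (a ↑ˡ n) j) (e₁₁ a) (e₁₂ a))
        (λ a → splitAt-elim (λ j → M (n ↑ʳ a) j ≡ N (n ↑ʳ a) j) (e₂₁ a) (e₂₂ a))

    module _ (A B C D : Mat n) (M : Mat (n ℕ.+ n)) (a : Fin n) (j : Fin (n ℕ.+ n)) where
      block-⊗-↑ˡ : (block A B C D ⊗ M) (a ↑ˡ n) j ≡ ∑ (λ m → A a m * M (m ↑ˡ n) j) + ∑ (λ m → B a m * M (n ↑ʳ m) j)
      block-⊗-↑ˡ = trans (∑-splitAt n (λ k → block A B C D (a ↑ˡ n) k * M k j))
        (cong₂ _+_ (∑-cong (λ m → cong (_* M (m ↑ˡ n) j) (block-↑ˡ-↑ˡ A B C D a m)))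
                   (∑-cong (λ m → cong (_* M (n ↑ʳ m) j) (block-↑ˡ-↑ʳ A B C D a m))))

      block-⊗-↑ʳ : (block A B C D ⊗ M) (n ↑ʳ a) j ≡ ∑ (λ m → C a m * M (m ↑ˡ n) j) + ∑ (λ m → D a m * M (n ↑ʳ m) j)
      block-⊗-↑ʳ = trans (∑-splitAt n (λ k → block A B C D (n ↑ʳ a) k * M k j))
        (cong₂ _+_ (∑-cong (λ m → cong (_* M (m ↑ˡ n) j) (block-↑ʳ-↑ˡ A B C D a m)))
                   (∑-cong (λ m → cong (_* M (n ↑ʳ m) j) (block-↑ʳ-↑ʳ A B C D a m))))

    block-cong : ∀ {A B C D A' B' C' D' : Mat n} → A ≋ A' → B ≋ B' → C ≋ C' → D ≋ D' →
                 block A B C D ≋ block A' B' C' D'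
    block-cong A≋ B≋ C≋ D≋ i j with splitAt n i | splitAt n j
    ... | inj₁ a | inj₁ b = A≋ a b
    ... | inj₁ a | inj₂ b = B≋ a b
    ... | inj₂ a | inj₁ b = C≋ a b
    ... | inj₂ a | inj₂ b = D≋ a b

    ↑ˡ≢↑ʳ : ∀ (a b : Fin n) → a ↑ˡ n ≢ n ↑ʳ b
    ↑ˡ≢↑ʳ a b eq with trans (sym (splitAt-↑ˡ n a n)) (trans (cong (splitAt n) eq) (splitAt-↑ʳ n n b))
    ... | ()

    block-I : block {n} I Zero Zero I ≋ I
    block-I = ≋-byBlocks
      (λ a b → trans (block-↑ˡ-↑ˡ I Zero Zero I a b) (sym (I-reindex (_↑ˡ n) (FinP.↑ˡ-injective n _ _) a b)))
      (λ a b → trans (block-↑ˡ-↑ʳ I Zero Zero I a b) (sym (I-≢ (↑ˡ≢↑ʳ a b))))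
      (λ a b → trans (block-↑ʳ-↑ˡ I Zero Zero I a b) (sym (I-≢ (↑ˡ≢↑ʳ b a ∘ sym))))
      (λ a b → trans (block-↑ʳ-↑ʳ I Zero Zero I a b) (sym (I-reindex (n ↑ʳ_) (FinP.↑ʳ-injective n _ _) a b)))

    -- For C' the inverse of C this is the Levi factor diag(C, ᵗC⁻¹) of P⁺.
    levi : Mat n → Mat n → Mat (n ℕ.+ n)
    levi C C' = block C Zero Zero (transpose C')

    module _ (C C' : Mat n) (M : Mat (n ℕ.+ n)) (a : Fin n) (j : Fin (n ℕ.+ n)) where
      levi-⊗-↑ˡ : (levi C C' ⊗ M) (a ↑ˡ n) j ≡ ∑ (λ m → C a m * M (m ↑ˡ n) j)
      levi-⊗-↑ˡ = trans (block-⊗-↑ˡ C Zero Zero (transpose C') M a j)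
                        (trans (cong (∑ (λ m → C a m * M (m ↑ˡ n) j) +_) (∑-0* (λ m → M (n ↑ʳ m) j))) (+-identityʳ _))

      levi-⊗-↑ʳ : (levi C C' ⊗ M) (n ↑ʳ a) j ≡ ∑ (λ m → C' m a * M (n ↑ʳ m) j)
      levi-⊗-↑ʳ = trans (block-⊗-↑ʳ C Zero Zero (transpose C') M a j)
                        (trans (cong (_+ ∑ (λ m → C' m a * M (n ↑ʳ m) j)) (∑-0* (λ m → M (m ↑ˡ n) j))) (+-identityˡ _))

    levi-⊗ : ∀ C C' A A' → (levi C C' ⊗ levi A A') ≋ levi (C ⊗ A) (A' ⊗ C')
    levi-⊗ C C' A A' = ≋-byBlocks
      (λ a b → begin
        (levi C C' ⊗ levi A A') (a ↑ˡ n) (b ↑ˡ n)       ≡⟨ levi-⊗-↑ˡ C C' (levi A A') a (b ↑ˡ n) ⟩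
        ∑ (λ m → C a m * levi A A' (m ↑ˡ n) (b ↑ˡ n))   ≡⟨ ∑-cong (λ m → cong (C a m *_) (block-↑ˡ-↑ˡ A Zero Zero (transpose A') m b)) ⟩
        (C ⊗ A) a b                                     ≡⟨ block-↑ˡ-↑ˡ (C ⊗ A) Zero Zero (transpose (A' ⊗ C')) a b ⟨
        levi (C ⊗ A) (A' ⊗ C') (a ↑ˡ n) (b ↑ˡ n)        ∎)
      (λ a b → begin
        (levi C C' ⊗ levi A A') (a ↑ˡ n) (n ↑ʳ b)       ≡⟨ levi-⊗-↑ˡ C C' (levi A A') a (n ↑ʳ b) ⟩
        ∑ (λ m → C a m * levi A A' (m ↑ˡ n) (n ↑ʳ b))   ≡⟨ ∑-zero (λ m → trans (cong (C a m *_) (block-↑ˡ-↑ʳ A Zero Zero (transpose A') m b)) (zeroʳ _)) ⟩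
        0#                                              ≡⟨ block-↑ˡ-↑ʳ (C ⊗ A) Zero Zero (transpose (A' ⊗ C')) a b ⟨
        levi (C ⊗ A) (A' ⊗ C') (a ↑ˡ n) (n ↑ʳ b)        ∎)
      (λ a b → begin
        (levi C C' ⊗ levi A A') (n ↑ʳ a) (b ↑ˡ n)       ≡⟨ levi-⊗-↑ʳ C C' (levi A A') a (b ↑ˡ n) ⟩
        ∑ (λ m → C' m a * levi A A' (n ↑ʳ m) (b ↑ˡ n))  ≡⟨ ∑-zero (λ m → trans (cong (C' m a *_) (block-↑ʳ-↑ˡ A Zero Zero (transpose A') m b)) (zeroʳ _)) ⟩
        0#                                              ≡⟨ block-↑ʳ-↑ˡ (C ⊗ A) Zero Zero (transpose (A' ⊗ C')) a b ⟨
        levi (C ⊗ A) (A' ⊗ C') (n ↑ʳ a) (b ↑ˡ n)        ∎)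
      (λ a b → begin
        (levi C C' ⊗ levi A A') (n ↑ʳ a) (n ↑ʳ b)       ≡⟨ levi-⊗-↑ʳ C C' (levi A A') a (n ↑ʳ b) ⟩
        ∑ (λ m → C' m a * levi A A' (n ↑ʳ m) (n ↑ʳ b))  ≡⟨ ∑-cong (λ m → trans (cong (C' m a *_) (block-↑ʳ-↑ʳ A Zero Zero (transpose A') m b)) (*-comm _ _)) ⟩
        (A' ⊗ C') b a                                   ≡⟨ block-↑ʳ-↑ʳ (C ⊗ A) Zero Zero (transpose (A' ⊗ C')) a b ⟨
        levi (C ⊗ A) (A' ⊗ C') (n ↑ʳ a) (n ↑ʳ b)        ∎)
      where open ≡-Reasoning

    levi-inverse : ∀ {C C'} → (C' ⊗ C) ≋ I → (levi C' C ⊗ levi C C') ≋ I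
    levi-inverse {C} {C'} C'C≋I = begin
      levi C' C ⊗ levi C C'              ≈⟨ levi-⊗ C' C C C' ⟩
      levi (C' ⊗ C) (C' ⊗ C)             ≈⟨ block-cong C'C≋I ≋.refl ≋.refl (λ i j → C'C≋I j i) ⟩
      block {n} I Zero Zero (transpose I) ≈⟨ block-cong ≋.refl ≋.refl ≋.refl (λ a b → I-sym b a) ⟩
      block {n} I Zero Zero I            ≈⟨ block-I ⟩
      I                                  ∎
      where open ≋-Reasoning

    InP⁺-levi-⊗ : ∀ {C C'} → (C ⊗ C') ≋ I → (C' ⊗ C) ≋ I → ∀ {p} → InP⁺ n p → InP⁺ n (levi C C' ⊗ p)
    InP⁺-levi-⊗ {C} {C'} CC'≋I C'C≋I {p} (A , A' , AA'≋I , A'A≋I , B , B-sym , B-diag , p≋) =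
      C ⊗ A , A' ⊗ C' , ⊗-inverse CC'≋I AA'≋I , ⊗-inverse A'A≋I C'C≋I , B , B-sym , B-diag , (begin
        levi C C' ⊗ p                          ≈⟨ ⊗-cong ≋.refl p≋ ⟩
        levi C C' ⊗ (levi A A' ⊗ U)            ≈⟨ ⊗-assoc (levi C C') (levi A A') U ⟨
        (levi C C' ⊗ levi A A') ⊗ U            ≈⟨ ⊗-cong (levi-⊗ C C' A A') ≋.refl ⟩
        levi (C ⊗ A) (A' ⊗ C') ⊗ U             ∎)
      where
        U = block I B Zero I
        open ≋-Reasoning

    InDoubleCoset-levi-⊗ : ∀ {s C C'} → (C ⊗ C') ≋ I → (C' ⊗ C) ≋ I →
                           ∀ {g} → InDoubleCoset n s g → InDoubleCoset n s (levi C C' ⊗ g)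
    InDoubleCoset-levi-⊗ {s} {C} {C'} CC'≋I C'C≋I {g} (p₁ , p₂ , p₁∈P⁺ , p₂∈P⁺ , g≋) =
      levi C C' ⊗ p₁ , p₂ , InP⁺-levi-⊗ CC'≋I C'C≋I p₁∈P⁺ , p₂∈P⁺ , (begin
        h ⊗ g                    ≈⟨ ⊗-cong ≋.refl g≋ ⟩
        h ⊗ ((p₁ ⊗ σ) ⊗ p₂)      ≈⟨ ⊗-assoc h (p₁ ⊗ σ) p₂ ⟨
        (h ⊗ (p₁ ⊗ σ)) ⊗ p₂      ≈⟨ ⊗-cong (⊗-assoc h p₁ σ) ≋.refl ⟨
        ((h ⊗ p₁) ⊗ σ) ⊗ p₂      ∎)
      where
        h = levi C C'
        σ = σ⁺ n s
        open ≋-Reasoning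

    LeviInvariant : Mat (n ℕ.+ n) → Set
    LeviInvariant S = ∀ {C C'} → (C ⊗ C') ≋ I → (C' ⊗ C) ≋ I → (levi C C' ⊗ S) ≋ S

    module _ {s N : ℕ} {gs : Vec (Mat (n ℕ.+ n)) N} (E : EnumeratesDoubleCoset n s N gs) where
      open EnumeratesDoubleCoset E

      private
        G : Fin N → Mat (n ℕ.+ n)
        G = Vec.lookup gs

      StabilisesDoubleCoset : Mat (n ℕ.+ n) → Set
      StabilisesDoubleCoset h = ∀ {g} → InDoubleCoset n s g → InDoubleCoset n s (h ⊗ g)

      translate : ∀ {x} → StabilisesDoubleCoset x → Fin N → Fin N
      translate {x} x-stable k = proj₁ (complete (x ⊗ G k) (x-stable (sound k)))

      translate-spec : ∀ {x} (x-stable : StabilisesDoubleCoset x) k → (x ⊗ G k) ≋ G (translate x-stable k)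
      translate-spec {x} x-stable k = proj₂ (complete (x ⊗ G k) (x-stable (sound k)))

      translate-inverse : ∀ {x x'} (x-stable : StabilisesDoubleCoset x) (x'-stable : StabilisesDoubleCoset x') →
                          (x' ⊗ x) ≋ I → ∀ k → translate x'-stable (translate x-stable k) ≡ k
      translate-inverse {x} {x'} x-stable x'-stable x'x≋I k = distinct _ _ (begin
        G (translate x'-stable (translate x-stable k))  ≈⟨ translate-spec x'-stable (translate x-stable k) ⟨
        x' ⊗ G (translate x-stable k)                   ≈⟨ ⊗-cong ≋.refl (translate-spec x-stable k) ⟨
        x' ⊗ (x ⊗ G k)                                  ≈⟨ ⊗-assoc x' x (G k) ⟨
        (x' ⊗ x) ⊗ G k                                  ≈⟨ ⊗-cong x'x≋I ≋.refl ⟩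
        I ⊗ G k                                         ≈⟨ ⊗-identityˡ (G k) ⟩
        G k                                             ∎)
        where open ≋-Reasoning

      ∑ᴹ-translate : ∀ {h h'} → (h' ⊗ h) ≋ I → (h ⊗ h') ≋ I →
                     StabilisesDoubleCoset h → StabilisesDoubleCoset h' →
                     ∑ᴹ (λ k → h ⊗ G k) ≋ ∑ᴹ G
      ∑ᴹ-translate {h} {h'} h'h≋I hh'≋I h-stable h'-stable i j = begin
        ∑ (λ k → (h ⊗ G k) i j)                ≡⟨ ∑-cong (λ k → translate-spec h-stable k i j) ⟩
        ∑ (λ k → G (translate h-stable k) i j) ≡⟨ ∑-permute (λ k → G k i j) π ⟨
        ∑ (λ k → G k i j)                      ∎
        where
          open ≡-Reasoning
          π : Perm.Permutation N N
          π = Perm.permutation (translate h-stable) (translate h'-stable)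
                (translate-inverse h'-stable h-stable hh'≋I) (translate-inverse h-stable h'-stable h'h≋I)

      ∑ᴹ-leviInvariant : LeviInvariant (∑ᴹ G)
      ∑ᴹ-leviInvariant {C} {C'} CC'≋I C'C≋I = ≋.trans (⊗-distribˡ-∑ᴹ (levi C C') G)
        (∑ᴹ-translate (levi-inverse C'C≋I) (levi-inverse CC'≋I)
                      (InDoubleCoset-levi-⊗ {s} CC'≋I C'C≋I) (InDoubleCoset-levi-⊗ {s} C'C≋I CC'≋I))

    scalar : Carrier → Mat n
    scalar c a b = c * I a b

    ∑-scalar* : ∀ c a (f : Fin n → Carrier) → ∑ (λ k → scalar c a k * f k) ≡ c * f a
    ∑-scalar* c a f = begin
      ∑ (λ k → c * I a k * f k)    ≡⟨ ∑-cong (λ k → *-assoc c (I a k) (f k)) ⟩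
      ∑ (λ k → c * (I a k * f k))  ≡⟨ *-distribˡ-∑ c (λ k → I a k * f k) ⟨
      c * ∑ (λ k → I a k * f k)    ≡⟨ cong (c *_) (∑-I* a f) ⟩
      c * f a                      ∎
      where open ≡-Reasoning

    scalar-inverse : ∀ {c d} → c * d ≡ 1# → (scalar c ⊗ scalar d) ≋ I
    scalar-inverse {c} {d} cd≡1 a b = begin
      ∑ (λ k → scalar c a k * (d * I k b))  ≡⟨ ∑-scalar* c a (λ k → d * I k b) ⟩
      c * (d * I a b)                       ≡⟨ *-assoc c d (I a b) ⟨
      c * d * I a b                         ≡⟨ trans (cong (_* I a b) cd≡1) (*-identityˡ (I a b)) ⟩
      I a b                                 ∎
      where open ≡-Reasoning

    leviInvariant-diagonal≡0-scalar : ∀ {μ} → μ ≢ 0# → μ ≢ 1# →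
                                      ∀ {S} → LeviInvariant S → ∀ i → S i i ≡ 0#
    leviInvariant-diagonal≡0-scalar {μ} μ≢0 μ≢1 {S} S-invariant with inverse μ μ≢0
    ... | ν , μν≡1 = splitAt-elim (λ i → S i i ≡ 0#) top bottom
      where
        S-fixed : (levi (scalar μ) (scalar ν) ⊗ S) ≋ S
        S-fixed = S-invariant (scalar-inverse μν≡1) (scalar-inverse (trans (*-comm ν μ) μν≡1))

        ν≢1 : ν ≢ 1#
        ν≢1 ν≡1 = μ≢1 (trans (sym (*-identityʳ μ)) (trans (cong (μ *_) (sym ν≡1)) μν≡1))

        top : ∀ a → S (a ↑ˡ n) (a ↑ˡ n) ≡ 0#
        top a = fixedPoint≡0 μ≢1 (begin
          μ * S (a ↑ˡ n) (a ↑ˡ n)                                ≡⟨ ∑-scalar* μ a (λ m → S (m ↑ˡ n) (a ↑ˡ n)) ⟨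
          ∑ (λ m → scalar μ a m * S (m ↑ˡ n) (a ↑ˡ n))          ≡⟨ levi-⊗-↑ˡ (scalar μ) (scalar ν) S a (a ↑ˡ n) ⟨
          (levi (scalar μ) (scalar ν) ⊗ S) (a ↑ˡ n) (a ↑ˡ n)    ≡⟨ S-fixed (a ↑ˡ n) (a ↑ˡ n) ⟩
          S (a ↑ˡ n) (a ↑ˡ n)                                    ∎)
          where open ≡-Reasoning

        bottom : ∀ a → S (n ↑ʳ a) (n ↑ʳ a) ≡ 0#
        bottom a = fixedPoint≡0 ν≢1 (begin
          ν * S (n ↑ʳ a) (n ↑ʳ a)                                ≡⟨ ∑-scalar* ν a (λ m → S (n ↑ʳ m) (n ↑ʳ a)) ⟨
          ∑ (λ m → scalar ν a m * S (n ↑ʳ m) (n ↑ʳ a))          ≡⟨ ∑-cong (λ m → cong (λ e → ν * e * S (n ↑ʳ m) (n ↑ʳ a)) (I-sym a m)) ⟩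
          ∑ (λ m → scalar ν m a * S (n ↑ʳ m) (n ↑ʳ a))          ≡⟨ levi-⊗-↑ʳ (scalar μ) (scalar ν) S a (n ↑ʳ a) ⟨
          (levi (scalar μ) (scalar ν) ⊗ S) (n ↑ʳ a) (n ↑ʳ a)    ≡⟨ S-fixed (n ↑ʳ a) (n ↑ʳ a) ⟩
          S (n ↑ʳ a) (n ↑ʳ a)                                    ∎)
          where open ≡-Reasoning

    elementary : Fin n → Fin n → Carrier → Mat n
    elementary u v t a b = I a b + I a u * t * I v b

    ∑-elementary* : ∀ u v t a (f : Fin n → Carrier) → ∑ (λ k → elementary u v t a k * f k) ≡ f a + I a u * t * f v
    ∑-elementary* u v t a f = begin
      ∑ (λ k → (I a k + c * I v k) * f k)              ≡⟨ ∑-cong (λ k → distribʳ (f k) (I a k) (c * I v k)) ⟩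
      ∑ (λ k → I a k * f k + c * I v k * f k)          ≡⟨ ∑-distrib-+ (λ k → I a k * f k) (λ k → c * I v k * f k) ⟩
      ∑ (λ k → I a k * f k) + ∑ (λ k → c * I v k * f k) ≡⟨ cong₂ _+_ (∑-I* a f) (∑-scalar* c v f) ⟩
      f a + c * f v                                    ∎
      where
        c = I a u * t
        open ≡-Reasoning

    transpose-elementary : ∀ u v t → transpose (elementary u v t) ≋ elementary v u t
    transpose-elementary u v t a b = cong₂ _+_ (I-sym b a) (begin
      I b u * t * I v a  ≡⟨ cong₂ (λ x y → x * t * y) (I-sym b u) (I-sym v a) ⟩
      I u b * t * I a v  ≡⟨ *-comm (I u b * t) (I a v) ⟩
      I a v * (I u b * t) ≡⟨ cong (I a v *_) (*-comm (I u b) t) ⟩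
      I a v * (t * I u b) ≡⟨ *-assoc (I a v) t (I u b) ⟨
      I a v * t * I u b  ∎)
      where open ≡-Reasoning

    elementary-inverse : ∀ {u v} → u ≢ v → ∀ {s t} → s + t ≡ 0# → (elementary u v s ⊗ elementary u v t) ≋ I
    elementary-inverse {u} {v} u≢v {s} {t} s+t≡0 a b = begin
      (elementary u v s ⊗ elementary u v t) a b       ≡⟨ ∑-elementary* u v s a (λ k → elementary u v t k b) ⟩
      elementary u v t a b + p * s * elementary u v t v b ≡⟨ cong (λ e → elementary u v t a b + p * s * e) Eₜ-row-v ⟩
      I a b + p * t * y + p * s * y                   ≡⟨ +-assoc (I a b) (p * t * y) (p * s * y) ⟩
      I a b + (p * t * y + p * s * y)                 ≡⟨ cong (I a b +_) (sym (distribʳ y (p * t) (p * s))) ⟩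
      I a b + (p * t + p * s) * y                     ≡⟨ cong (λ e → I a b + e * y) (sym (distribˡ p t s)) ⟩
      I a b + p * (t + s) * y                         ≡⟨ cong (λ e → I a b + p * e * y) (trans (+-comm t s) s+t≡0) ⟩
      I a b + p * 0# * y                              ≡⟨ cong (λ e → I a b + e * y) (zeroʳ p) ⟩
      I a b + 0# * y                                  ≡⟨ trans (cong (I a b +_) (zeroˡ y)) (+-identityʳ (I a b)) ⟩
      I a b                                           ∎
      where
        p = I a u
        y = I v b
        open ≡-Reasoning
        Eₜ-row-v : elementary u v t v b ≡ I v b
        Eₜ-row-v = begin
          I v b + I v u * t * I v b  ≡⟨ cong (λ e → I v b + e * t * I v b) (I-≢ (u≢v ∘ sym)) ⟩
          I v b + 0# * t * I v b     ≡⟨ cong (λ e → I v b + e * I v b) (zeroˡ t) ⟩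
          I v b + 0# * I v b         ≡⟨ trans (cong (I v b +_) (zeroˡ (I v b))) (+-identityʳ (I v b)) ⟩
          I v b                      ∎

    leviInvariant-diagonal≡0-elementary : (∀ a → ∃ λ b → b ≢ a) →
                                          ∀ {S} → LeviInvariant S → ∀ i → S i i ≡ 0#
    leviInvariant-diagonal≡0-elementary other {S} S-invariant = splitAt-elim (λ i → S i i ≡ 0#) top bottom
      where
        E : Fin n → Fin n → Carrier → Mat n
        E = elementary

        absorbed : ∀ w {x y} → x + I w w * 1# * y ≡ x → y ≡ 0#
        absorbed w {x} {y} eq = begin
          y                 ≡⟨ trans (*-identityˡ (1# * y)) (*-identityˡ y) ⟨
          1# * (1# * y)     ≡⟨ trans (cong (λ e → e * (1# * y)) (sym (I-diag w))) (sym (*-assoc (I w w) 1# y)) ⟩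
          I w w * 1# * y    ≡⟨ +-identityʳ-unique x (I w w * 1# * y) eq ⟩
          0#                ∎
          where open ≡-Reasoning

        top : ∀ a → S (a ↑ˡ n) (a ↑ˡ n) ≡ 0#
        top a = absorbed u (begin
          S (u ↑ˡ n) (a ↑ˡ n) + I u u * 1# * S (a ↑ˡ n) (a ↑ˡ n)    ≡⟨ ∑-elementary* u a 1# u (λ m → S (m ↑ˡ n) (a ↑ˡ n)) ⟨
          ∑ (λ m → E u a 1# u m * S (m ↑ˡ n) (a ↑ˡ n))              ≡⟨ levi-⊗-↑ˡ (E u a 1#) (E u a (- 1#)) S u (a ↑ˡ n) ⟨
          (levi (E u a 1#) (E u a (- 1#)) ⊗ S) (u ↑ˡ n) (a ↑ˡ n)    ≡⟨ S-fixed (u ↑ˡ n) (a ↑ˡ n) ⟩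
          S (u ↑ˡ n) (a ↑ˡ n)                                         ∎)
          where
            u = proj₁ (other a)
            S-fixed = S-invariant (elementary-inverse (proj₂ (other a)) (-‿inverseʳ 1#))
                                  (elementary-inverse (proj₂ (other a)) (-‿inverseˡ 1#))
            open ≡-Reasoning

        bottom : ∀ a → S (n ↑ʳ a) (n ↑ʳ a) ≡ 0#
        bottom a = absorbed v (begin
          S (n ↑ʳ v) (n ↑ʳ a) + I v v * 1# * S (n ↑ʳ a) (n ↑ʳ a)    ≡⟨ ∑-elementary* v a 1# v (λ m → S (n ↑ʳ m) (n ↑ʳ a)) ⟨
          ∑ (λ m → E v a 1# v m * S (n ↑ʳ m) (n ↑ʳ a))              ≡⟨ ∑-cong (λ m → cong (_* S (n ↑ʳ m) (n ↑ʳ a)) (transpose-elementary a v 1# v m)) ⟨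
          ∑ (λ m → E a v 1# m v * S (n ↑ʳ m) (n ↑ʳ a))              ≡⟨ levi-⊗-↑ʳ (E a v (- 1#)) (E a v 1#) S v (n ↑ʳ a) ⟨
          (levi (E a v (- 1#)) (E a v 1#) ⊗ S) (n ↑ʳ v) (n ↑ʳ a)    ≡⟨ S-fixed (n ↑ʳ v) (n ↑ʳ a) ⟩
          S (n ↑ʳ v) (n ↑ʳ a)                                         ∎)
          where
            v = proj₁ (other a)
            a≢v = proj₂ (other a) ∘ sym
            S-fixed = S-invariant (elementary-inverse a≢v (-‿inverseˡ 1#))
                                  (elementary-inverse a≢v (-‿inverseʳ 1#))
            open ≡-Reasoning

  _≟_ : DecidableEquality Carrier
  _≟_ = via-injection (↔⇒↣ enum) FinP._≟_

  binary⊎third : (∀ x → x ≡ 0# ⊎ x ≡ 1#) ⊎ ∃ λ μ → μ ≢ 0# × μ ≢ 1#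
  binary⊎third with FinP.any? (λ k → ¬? (Inverse.from enum k ≟ 0#) ×-dec ¬? (Inverse.from enum k ≟ 1#))
  ... | yes (k , third) = inj₂ (Inverse.from enum k , third)
  ... | no ¬third = inj₁ binary
    where
      binary : ∀ x → x ≡ 0# ⊎ x ≡ 1#
      binary x with x ≟ 0# | x ≟ 1#
      ... | yes x≡0 | _       = inj₁ x≡0
      ... | no _    | yes x≡1 = inj₂ x≡1
      ... | no x≢0  | no x≢1  = ⊥-elim (¬third (Inverse.to enum x ,
            subst (λ y → y ≢ 0# × y ≢ 1#) (sym (Inverse.strictlyInverseʳ enum x)) (x≢0 , x≢1)))

  module Binary (binary : ∀ x → x ≡ 0# ⊎ x ≡ 1#) where
    x+x≡0 : ∀ x → x + x ≡ 0#
    x+x≡0 x with binary x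
    ... | inj₁ refl = +-identityˡ 0#
    ... | inj₂ refl with binary (1# + 1#)
    ...   | inj₁ 1+1≡0 = 1+1≡0
    ...   | inj₂ 1+1≡1 = ⊥-elim (0≢1 (sym (+-identityʳ-unique 1# 1# 1+1≡1)))

    unit≡1 : ∀ {x y} → x * y ≡ 1# → x ≡ 1#
    unit≡1 {x} {y} xy≡1 with binary x
    ... | inj₂ x≡1 = x≡1
    ... | inj₁ refl = ⊥-elim (0≢1 (trans (sym (zeroˡ y)) xy≡1))

    ≋-1×1 : {M N : Mat 1} → M zero zero ≡ N zero zero → M ≋ N
    ≋-1×1 eq zero zero = eq

    InP⁺₁≋I : ∀ {p} → InP⁺ 1 p → p ≋ I
    InP⁺₁≋I {p} (A , A' , AA'≋I , A'A≋I , B , _ , B-diag , p≋) = begin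
      p                                              ≈⟨ p≋ ⟩
      levi A A' ⊗ block I B Zero I                   ≈⟨ ⊗-cong (block-cong A≋I ≋.refl ≋.refl A'ᵗ≋I) (block-cong ≋.refl B≋0 ≋.refl ≋.refl) ⟩
      block {1} I Zero Zero I ⊗ block {1} I Zero Zero I ≈⟨ ⊗-cong (block-I {1}) (block-I {1}) ⟩
      I {2} ⊗ I                                      ≈⟨ ⊗-identityˡ I ⟩
      I                                              ∎
      where
        open ≋-Reasoning
        A≋I : A ≋ I
        A≋I = ≋-1×1 (unit≡1 (trans (sym (+-identityʳ _)) (AA'≋I zero zero)))
        A'ᵗ≋I : transpose A' ≋ I
        A'ᵗ≋I = ≋-1×1 (unit≡1 (trans (sym (+-identityʳ _)) (A'A≋I zero zero)))
        B≋0 : B ≋ Zero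
        B≋0 = ≋-1×1 (B-diag zero)

    InDoubleCoset₁≋σ⁺ : ∀ {s g} → InDoubleCoset 1 s g → g ≋ σ⁺ 1 s
    InDoubleCoset₁≋σ⁺ {s} {g} (p₁ , p₂ , p₁∈P⁺ , p₂∈P⁺ , g≋) = begin
      g                       ≈⟨ g≋ ⟩
      (p₁ ⊗ σ⁺ 1 s) ⊗ p₂      ≈⟨ ⊗-cong (⊗-cong (InP⁺₁≋I p₁∈P⁺) (≋.refl {x = σ⁺ 1 s})) (InP⁺₁≋I p₂∈P⁺) ⟩
      (I ⊗ σ⁺ 1 s) ⊗ I        ≈⟨ ⊗-identityʳ (I ⊗ σ⁺ 1 s) ⟩
      I ⊗ σ⁺ 1 s              ≈⟨ ⊗-identityˡ (σ⁺ 1 s) ⟩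
      σ⁺ 1 s                  ∎
      where open ≋-Reasoning

    Tr-InDoubleCoset₁ : ∀ {s g} → InDoubleCoset 1 s g → Tr g ≡ 0#
    Tr-InDoubleCoset₁ {s} g∈ = trans (Tr-cong {N = σ⁺ 1 s} (InDoubleCoset₁≋σ⁺ {s} g∈))
      (trans (cong (d +_) (+-identityʳ d)) (x+x≡0 d))
      where d = σ⁺ 1 s zero zero

  diagonal≡0⇒traceSum≡0 : ∀ {m N} (G : Fin N → Mat m) → (∀ i → ∑ᴹ G i i ≡ 0#) → ∑ (λ k → Tr (G k)) ≡ 0#
  diagonal≡0⇒traceSum≡0 G diagonal≡0 = trans (sym (Tr-∑ᴹ G)) (∑-zero diagonal≡0)

  traceSum≡0 : ∀ {n s N} {gs : Vec (Mat (n ℕ.+ n)) N} → EnumeratesDoubleCoset n s N gs →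
               ∑ (λ k → Tr (Vec.lookup gs k)) ≡ 0#
  traceSum≡0 {zero} {gs = gs} E = ∑-zero {f = λ k → Tr (Vec.lookup gs k)} (λ _ → refl)
  traceSum≡0 {suc zero} {s} {gs = gs} E with binary⊎third
  ... | inj₁ binary = ∑-zero {f = λ k → Tr (Vec.lookup gs k)} (λ k → Binary.Tr-InDoubleCoset₁ binary {s} (EnumeratesDoubleCoset.sound E k))
  ... | inj₂ (μ , μ≢0 , μ≢1) = diagonal≡0⇒traceSum≡0 (Vec.lookup gs)
    (leviInvariant-diagonal≡0-scalar μ≢0 μ≢1 (∑ᴹ-leviInvariant E))
  traceSum≡0 {suc (suc m)} {gs = gs} E = diagonal≡0⇒traceSum≡0 (Vec.lookup gs)
    (leviInvariant-diagonal≡0-elementary (λ a → Fin.punchIn a zero , FinP.punchInᵢ≢i a zero) (∑ᴹ-leviInvariant E))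

  +≡0⇒≡0⇔≡0 : ∀ {x y} → x + y ≡ 0# → (x ≡ 0# ⇔ y ≡ 0#)
  +≡0⇒≡0⇔≡0 {x} {y} x+y≡0 = mk⇔
    (λ x≡0 → trans (sym (+-identityˡ y)) (trans (cong (_+ y) (sym x≡0)) x+y≡0))
    (λ y≡0 → trans (sym (+-identityʳ x)) (trans (cong (x +_) (sym y≡0)) x+y≡0))

  complement : ∀ {M} → Vec Bool M → Vec Bool M
  complement = Vec.map not

  weight≤length : ∀ {M} (u : Vec Bool M) → weight u ≤ M
  weight≤length []          = ℕ.z≤n
  weight≤length (false ∷ u) = ℕP.m≤n⇒m≤1+n (weight≤length u)
  weight≤length (true ∷ u)  = ℕ.s≤s (weight≤length u)

  weight-complement : ∀ {M} (u : Vec Bool M) → weight (complement u) ≡ M ∸ weight u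
  weight-complement []          = refl
  weight-complement (false ∷ u) = trans (cong suc (weight-complement u)) (sym (ℕP.+-∸-assoc 1 (weight≤length u)))
  weight-complement (true ∷ u)  = weight-complement u

  map-complement-allVecs : ∀ M → map complement (allVecs M) ↭ allVecs M
  map-complement-allVecs zero    = ↭-refl
  map-complement-allVecs (suc M) = begin
    map complement (map (false ∷_) A ++ map (true ∷_) A)                   ≡⟨ ListP.map-++ complement (map (false ∷_) A) (map (true ∷_) A) ⟩
    map complement (map (false ∷_) A) ++ map complement (map (true ∷_) A)  ≡⟨ cong₂ _++_ (flip-head false) (flip-head true) ⟩
    map (true ∷_) (map complement A) ++ map (false ∷_) (map complement A)  ↭⟨ ↭P.++⁺ (↭P.map⁺ (true ∷_) IH) (↭P.map⁺ (false ∷_) IH) ⟩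
    map (true ∷_) A ++ map (false ∷_) A                                    ↭⟨ ↭P.++-comm (map (true ∷_) A) (map (false ∷_) A) ⟩
    map (false ∷_) A ++ map (true ∷_) A                                    ∎
    where
      open PermutationReasoning
      A = allVecs M
      IH = map-complement-allVecs M
      flip-head : ∀ b → map complement (map (b ∷_) A) ≡ map (not b ∷_) (map complement A)
      flip-head b = trans (sym (ListP.map-∘ {g = complement} {f = b ∷_} A)) (ListP.map-∘ {g = not b ∷_} {f = complement} A)

  module _ {n N : ℕ} (gs : Vec (Mat (n ℕ.+ n)) N) (traceSum≡0 : ∑ (λ k → Tr (Vec.lookup gs k)) ≡ 0#) where
    private
      codeSum : Vec Bool N → Carrier
      codeSum u = ∑ (λ k → if Vec.lookup u k then Tr (Vec.lookup gs k) else 0#)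

      codeSum-complement : ∀ u → codeSum (complement u) + codeSum u ≡ 0#
      codeSum-complement u = begin
        codeSum (complement u) + codeSum u                                  ≡⟨ ∑-distrib-+ (select (complement u)) (select u) ⟨
        ∑ (λ k → select (complement u) k + select u k)                      ≡⟨ ∑-cong select-complement ⟩
        ∑ (λ k → Tr (Vec.lookup gs k))                                      ≡⟨ traceSum≡0 ⟩
        0#                                                                  ∎
        where
          open ≡-Reasoning
          select : Vec Bool N → Fin N → Carrier
          select v k = if Vec.lookup v k then Tr (Vec.lookup gs k) else 0#
          select-complement : ∀ k → select (complement u) k + select u k ≡ Tr (Vec.lookup gs k)
          select-complement k rewrite VecP.lookup-map k not u with Vec.lookup u k
          ... | false = +-identityʳ _
          ... | true  = +-identityˡ _

    -- inCodeᵇ tests x == 0#, which is definitionally does (x ≟ 0#): via-injection keeps the Fin test.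
    inCodeᵇ-complement : ∀ u → inCodeᵇ {n} gs (complement u) ≡ inCodeᵇ {n} gs u
    inCodeᵇ-complement u = does-⇔ (+≡0⇒≡0⇔≡0 (codeSum-complement u)) (codeSum (complement u) ≟ 0#) (codeSum u ≟ 0#)

    weightDistribution-reflect : ∀ j → j ≤ N → weightDistribution {n} gs j ≡ weightDistribution {n} gs (N ∸ j)
    weightDistribution-reflect j j≤N = begin
      length (filterᵇ (codewordOfWeight j) (allVecs N))                           ≡⟨ length-filterᵇ-map complement codewordOfWeight-complement (allVecs N) ⟨
      length (filterᵇ (codewordOfWeight (N ∸ j)) (map complement (allVecs N)))   ≡⟨ ↭P.↭-length (↭P.filter-↭ (T? ∘ codewordOfWeight (N ∸ j)) (map-complement-allVecs N)) ⟩
      length (filterᵇ (codewordOfWeight (N ∸ j)) (allVecs N))                     ∎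
      where
        open ≡-Reasoning
        codewordOfWeight : ℕ → Vec Bool N → Bool
        codewordOfWeight w u = inCodeᵇ {n} gs u ∧ does (weight u ℕ.≟ w)

        codewordOfWeight-complement : ∀ u → codewordOfWeight (N ∸ j) (complement u) ≡ codewordOfWeight j u
        codewordOfWeight-complement u = cong₂ _∧_ (inCodeᵇ-complement u) (begin
          does (weight (complement u) ℕ.≟ N ∸ j)  ≡⟨ cong (λ w → does (w ℕ.≟ N ∸ j)) (weight-complement u) ⟩
          does (N ∸ weight u ℕ.≟ N ∸ j)           ≡⟨ does-⇔ (mk⇔ (ℕP.∸-cancelˡ-≡ (weight≤length u) j≤N) (cong (N ∸_)))
                                                       (N ∸ weight u ℕ.≟ N ∸ j) (weight u ℕ.≟ j) ⟩
          does (weight u ℕ.≟ j)                   ∎)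

-- The trace sum vanishes over every finite field and for every s.
corollary17 :
    (r : ℕ) (F : FiniteField (2 ^ r)) (i n : ℕ) → (i ≡ 1 ⊎ i ≡ 2) → i ≤ n →
    (N : ℕ) (gs : Vec (Matrices.Mat F (n Data.Nat.+ n)) N) →
    Matrices.EnumeratesDoubleCoset F n (n ∸ i) N gs →
    (j : ℕ) → j ≤ N →
      Matrices.weightDistribution F {n} gs j ≡ Matrices.weightDistribution F {n} gs (N ∸ j)
corollary17 r F i n _ _ N gs E = Over.weightDistribution-reflect F {n} gs (Over.traceSum≡0 F E)
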